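{- Let $k\ge0$ and let $T$ be a theory (in the language of $\mathsf{HA}$) containing $\mathsf{HA}$. If $\mathsf{PA}$ is $(\Sigma_k\lor\Pi_k)$-conservative over $T$, then $T\vdash\mathrm{LEM}(\Sigma_k)$.
   Context: $\mathsf{HA}$ is intuitionistic first-order arithmetic with function symbols for all primitive recursive functions and logical constants $\forall,\exists,\to,\land,\lor,\perp$ ($\neg\varphi:\equiv\varphi\to\perp$); $\mathsf{PA}$ is $\mathsf{HA}$ plus excluded middle for all formulas. $\Sigma_0=\Pi_0$ = quantifier-free formulas; $\Sigma_{k+1}$ = formulas $\exists x_1\cdots\exists x_n\varphi$ with $\varphi\in\Pi_k$; $\Pi_{k+1}$ = formulas $\forall x_1\cdots\forall x_n\varphi$ with $\varphi\in\Sigma_k$. $\Sigma_k\lor\Pi_k$ is the class of formulas $\varphi\lor\psi$ with $\varphi\in\Sigma_k,\psi\in\Pi_k$. $T'$ is $\Gamma$-conservative over $T$ if every formula of $\Gamma$ provable in $T'$ is provable in $T$. $\mathrm{LEM}(\Sigma_k)$ is the scheme $\varphi\lor\neg\varphi$ for $\varphi\in\Sigma_k$ (free variables allowed). -}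

module Defs where

open import Data.Nat using (ℕ; zero; suc)
open import Data.Fin using (Fin; toℕ)
open import Data.Vec using (Vec; []; _∷_; tabulate)
import Data.Vec as Vec
open import Data.List using (List; []; _∷_)
import Data.List as List
open import Data.List.Membership.Propositional using (_∈_)
open import Data.Product using (Σ; _,_)
open import Data.Sum using (_⊎_)
open import Relation.Binary.PropositionalEquality using (_≡_)

-- Codes for primitive recursive functions (one function symbol each)

data PR : ℕ → Set where
  zeroF : PR 0
  succF : PR 1
  projF : ∀ {n} → Fin n → PR n
  compF : ∀ {m n} → PR m → Vec (PR n) m → PR n
  recF  : ∀ {n} → PR n → PR (suc (suc n)) → PR (suc n)

-- Terms and formulas of the language of HA (de Bruijn variables)

data Tm : Set where
  var : ℕ → Tm
  app : ∀ {n} → PR n → Vec Tm n → Tm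

infix  7 _≐_
infixr 6 _∧'_
infixr 5 _∨'_
infixr 4 _⇒_

data Fm : Set where
  _≐_  : Tm → Tm → Fm
  ⊥'   : Fm
  _⇒_  : Fm → Fm → Fm
  _∧'_ : Fm → Fm → Fm
  _∨'_ : Fm → Fm → Fm
  ∀'   : Fm → Fm        -- binds variable 0
  ∃'   : Fm → Fm

¬' : Fm → Fm
¬' φ = φ ⇒ ⊥'

Z : Tm
Z = app zeroF []

S : Tm → Tm
S t = app succF (t ∷ [])

Subst : Set
Subst = ℕ → Tm

mutual
  subT : Subst → Tm → Tm
  subT σ (var x)    = σ x
  subT σ (app f ts) = app f (subTs σ ts)

  subTs : ∀ {n} → Subst → Vec Tm n → Vec Tm n
  subTs σ []       = []
  subTs σ (t ∷ ts) = subT σ t ∷ subTs σ ts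

↑T : Tm → Tm
↑T = subT (λ x → var (suc x))

_∷ₛ_ : Tm → Subst → Subst
(t ∷ₛ σ) zero    = t
(t ∷ₛ σ) (suc x) = σ x

lift : Subst → Subst
lift σ = var 0 ∷ₛ (λ x → ↑T (σ x))

subF : Subst → Fm → Fm
subF σ (t ≐ s)  = subT σ t ≐ subT σ s
subF σ ⊥'       = ⊥'
subF σ (φ ⇒ ψ)  = subF σ φ ⇒ subF σ ψ
subF σ (φ ∧' ψ) = subF σ φ ∧' subF σ ψ
subF σ (φ ∨' ψ) = subF σ φ ∨' subF σ ψ
subF σ (∀' φ)   = ∀' (subF (lift σ) φ)
subF σ (∃' φ)   = ∃' (subF (lift σ) φ)

↑F : Fm → Fm
↑F = subF (λ x → var (suc x))

-- φ [ t ] : substitute t for variable 0 (and lower the other variables)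
_[_] : Fm → Tm → Fm
φ [ t ] = subF (t ∷ₛ var) φ

-- Intuitionistic natural deduction over an axiom set.
-- Axioms with free variables are read as their universal closures:
-- every substitution instance of an axiom may be used.

Theory : Set₁
Theory = Fm → Set

infix 2 _∣_⊢_

data _∣_⊢_ (Ax : Theory) : List Fm → Fm → Set where
  hyp   : ∀ {Γ φ} → φ ∈ Γ → Ax ∣ Γ ⊢ φ
  ax    : ∀ {Γ φ} → Ax φ → (σ : Subst) → Ax ∣ Γ ⊢ subF σ φ
  ⇒I    : ∀ {Γ φ ψ} → Ax ∣ φ ∷ Γ ⊢ ψ → Ax ∣ Γ ⊢ φ ⇒ ψ
  ⇒E    : ∀ {Γ φ ψ} → Ax ∣ Γ ⊢ φ ⇒ ψ → Ax ∣ Γ ⊢ φ → Ax ∣ Γ ⊢ ψ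
  ∧I    : ∀ {Γ φ ψ} → Ax ∣ Γ ⊢ φ → Ax ∣ Γ ⊢ ψ → Ax ∣ Γ ⊢ φ ∧' ψ
  ∧E₁   : ∀ {Γ φ ψ} → Ax ∣ Γ ⊢ φ ∧' ψ → Ax ∣ Γ ⊢ φ
  ∧E₂   : ∀ {Γ φ ψ} → Ax ∣ Γ ⊢ φ ∧' ψ → Ax ∣ Γ ⊢ ψ
  ∨I₁   : ∀ {Γ φ ψ} → Ax ∣ Γ ⊢ φ → Ax ∣ Γ ⊢ φ ∨' ψ
  ∨I₂   : ∀ {Γ φ ψ} → Ax ∣ Γ ⊢ ψ → Ax ∣ Γ ⊢ φ ∨' ψ
  ∨E    : ∀ {Γ φ ψ χ} → Ax ∣ Γ ⊢ φ ∨' ψ → Ax ∣ φ ∷ Γ ⊢ χ → Ax ∣ ψ ∷ Γ ⊢ χ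
          → Ax ∣ Γ ⊢ χ
  ⊥E    : ∀ {Γ φ} → Ax ∣ Γ ⊢ ⊥' → Ax ∣ Γ ⊢ φ
  ∀I    : ∀ {Γ φ} → Ax ∣ List.map ↑F Γ ⊢ φ → Ax ∣ Γ ⊢ ∀' φ
  ∀E    : ∀ {Γ φ} → Ax ∣ Γ ⊢ ∀' φ → (t : Tm) → Ax ∣ Γ ⊢ φ [ t ]
  ∃I    : ∀ {Γ φ} → (t : Tm) → Ax ∣ Γ ⊢ φ [ t ] → Ax ∣ Γ ⊢ ∃' φ
  ∃E    : ∀ {Γ φ ψ} → Ax ∣ Γ ⊢ ∃' φ → Ax ∣ φ ∷ List.map ↑F Γ ⊢ ↑F ψ
          → Ax ∣ Γ ⊢ ψ
  ≐refl : ∀ {Γ t} → Ax ∣ Γ ⊢ t ≐ t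
  ≐subst : ∀ {Γ φ t s} → Ax ∣ Γ ⊢ t ≐ s → Ax ∣ Γ ⊢ φ [ t ] → Ax ∣ Γ ⊢ φ [ s ]

_⊢_ : Theory → Fm → Set
T ⊢ φ = T ∣ [] ⊢ φ

vars : ∀ n → Vec Tm n
vars n = tabulate (λ i → var (toℕ i))

vars₁ : ∀ n → Vec Tm n
vars₁ n = tabulate (λ i → var (suc (toℕ i)))

data HA-Ax : Fm → Set where
  succ-nz  : HA-Ax (¬' (S (var 0) ≐ Z))
  succ-inj : HA-Ax (S (var 0) ≐ S (var 1) ⇒ var 0 ≐ var 1)
  proj-eq  : ∀ {n} (i : Fin n) → HA-Ax (app (projF i) (vars n) ≐ var (toℕ i))
  comp-eq  : ∀ {m n} (f : PR m) (gs : Vec (PR n) m) →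
             HA-Ax (app (compF f gs) (vars n)
                      ≐ app f (Vec.map (λ g → app g (vars n)) gs))
  rec-eq₀  : ∀ {n} (g : PR n) (h : PR (suc (suc n))) →
             HA-Ax (app (recF g h) (Z ∷ vars₁ n) ≐ app g (vars₁ n))
  rec-eqₛ  : ∀ {n} (g : PR n) (h : PR (suc (suc n))) →
             HA-Ax (app (recF g h) (S (var 0) ∷ vars₁ n)
                      ≐ app h (var 0 ∷ app (recF g h) (var 0 ∷ vars₁ n) ∷ vars₁ n))
  ind      : ∀ φ → HA-Ax (φ [ Z ] ⇒ ∀' (φ ⇒ subF (S (var 0) ∷ₛ (λ x → var (suc x))) φ)
                          ⇒ ∀' φ)

data PA-Ax : Fm → Set where
  ha  : ∀ {φ} → HA-Ax φ → PA-Ax φ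
  lem : ∀ φ → PA-Ax (φ ∨' ¬' φ)

data QF : Fm → Set where
  qf≐ : ∀ t s → QF (t ≐ s)
  qf⊥ : QF ⊥'
  qf⇒ : ∀ {φ ψ} → QF φ → QF ψ → QF (φ ⇒ ψ)
  qf∧ : ∀ {φ ψ} → QF φ → QF ψ → QF (φ ∧' ψ)
  qf∨ : ∀ {φ ψ} → QF φ → QF ψ → QF (φ ∨' ψ)

mutual
  -- Σ_k : Σ_0 = QF; Σ_{k+1} = ∃x₁⋯∃xₙ φ with φ ∈ Π_k (n ≥ 0)
  data Sig : ℕ → Fm → Set where
    sig0 : ∀ {φ} → QF φ → Sig 0 φ
    sigΠ : ∀ {k φ} → Pi k φ → Sig (suc k) φ
    sig∃ : ∀ {k φ} → Sig (suc k) φ → Sig (suc k) (∃' φ)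

  -- Π_k : Π_0 = QF; Π_{k+1} = ∀x₁⋯∀xₙ φ with φ ∈ Σ_k (n ≥ 0)
  data Pi : ℕ → Fm → Set where
    pi0 : ∀ {φ} → QF φ → Pi 0 φ
    piΣ : ∀ {k φ} → Sig k φ → Pi (suc k) φ
    pi∀ : ∀ {k φ} → Pi (suc k) φ → Pi (suc k) (∀' φ)

data SigOrPi (k : ℕ) : Fm → Set where
  sigOrPi : ∀ {φ ψ} → Sig k φ → Pi k ψ → SigOrPi k (φ ∨' ψ)

ContainsHA : Theory → Set
ContainsHA T = ∀ φ → HA-Ax φ → T φ

Conservative : (Fm → Set) → Theory → Theory → Set
Conservative Γ T' T = ∀ φ → Γ φ → T' ⊢ φ → T ⊢ φ

ProvesLEM-Sig : ℕ → Theory → Set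
ProvesLEM-Sig k T = ∀ φ → Sig k φ → T ⊢ (φ ∨' ¬' φ)

module Submission where

-- Every Σ_k formula φ has a dual φ^⊥ ∈ Π_k (push ¬ through the quantifier prefix onto the
-- quantifier-free matrix).  PA proves φ ∨ φ^⊥, a (Σ_k ∨ Π_k)-formula, so T proves it by
-- conservativity; and φ^⊥ → ¬φ holds in pure intuitionistic logic, so T proves φ ∨ ¬φ.

open import Defs
open import Data.Nat using (ℕ; zero; suc)
open import Data.Vec using (Vec; []; _∷_)
open import Data.List using ([]; _∷_)
open import Data.List.Relation.Unary.Any using (here; there)
open import Function using (_∘_)
open import Relation.Binary.PropositionalEquality
  using (_≡_; _≗_; refl; sym; trans; cong; cong₂; subst; module ≡-Reasoning)

weaken : Subst
weaken x = var (suc x)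

mutual
  subT-fusion : ∀ {σ τ ρ} → subT τ ∘ σ ≗ ρ → ∀ t → subT τ (subT σ t) ≡ subT ρ t
  subT-fusion h (var x)    = h x
  subT-fusion h (app f ts) = cong (app f) (subTs-fusion h ts)

  subTs-fusion : ∀ {σ τ ρ n} → subT τ ∘ σ ≗ ρ →
                 (ts : Vec Tm n) → subTs τ (subTs σ ts) ≡ subTs ρ ts
  subTs-fusion h []       = refl
  subTs-fusion h (t ∷ ts) = cong₂ _∷_ (subT-fusion h t) (subTs-fusion h ts)

lift-fusion : ∀ {σ τ ρ} → subT τ ∘ σ ≗ ρ → subT (lift τ) ∘ lift σ ≗ lift ρ
lift-fusion h zero = refl
lift-fusion {σ} {τ} {ρ} h (suc x) = begin
  subT (lift τ) (↑T (σ x))  ≡⟨ subT-fusion (λ _ → refl) (σ x) ⟩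
  subT (↑T ∘ τ) (σ x)       ≡⟨ sym (subT-fusion (λ _ → refl) (σ x)) ⟩
  ↑T (subT τ (σ x))         ≡⟨ cong ↑T (h x) ⟩
  ↑T (ρ x)                  ∎
  where open ≡-Reasoning

subF-fusion : ∀ {σ τ ρ} → subT τ ∘ σ ≗ ρ → ∀ φ → subF τ (subF σ φ) ≡ subF ρ φ
subF-fusion h (t ≐ s)  = cong₂ _≐_ (subT-fusion h t) (subT-fusion h s)
subF-fusion h ⊥'       = refl
subF-fusion h (φ ⇒ ψ)  = cong₂ _⇒_ (subF-fusion h φ) (subF-fusion h ψ)
subF-fusion h (φ ∧' ψ) = cong₂ _∧'_ (subF-fusion h φ) (subF-fusion h ψ)
subF-fusion h (φ ∨' ψ) = cong₂ _∨'_ (subF-fusion h φ) (subF-fusion h ψ)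
subF-fusion {σ} {τ} {ρ} h (∀' φ) = cong ∀' (subF-fusion (lift-fusion {σ} {τ} {ρ} h) φ)
subF-fusion {σ} {τ} {ρ} h (∃' φ) = cong ∃' (subF-fusion (lift-fusion {σ} {τ} {ρ} h) φ)

mutual
  subT-id : ∀ {σ} → σ ≗ var → ∀ t → subT σ t ≡ t
  subT-id h (var x)    = h x
  subT-id h (app f ts) = cong (app f) (subTs-id h ts)

  subTs-id : ∀ {σ n} → σ ≗ var → (ts : Vec Tm n) → subTs σ ts ≡ ts
  subTs-id h []       = refl
  subTs-id h (t ∷ ts) = cong₂ _∷_ (subT-id h t) (subTs-id h ts)

lift-id : ∀ {σ} → σ ≗ var → lift σ ≗ var
lift-id h zero    = refl
lift-id h (suc x) = cong ↑T (h x)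

subF-id : ∀ {σ} → σ ≗ var → ∀ φ → subF σ φ ≡ φ
subF-id h (t ≐ s)  = cong₂ _≐_ (subT-id h t) (subT-id h s)
subF-id h ⊥'       = refl
subF-id h (φ ⇒ ψ)  = cong₂ _⇒_ (subF-id h φ) (subF-id h ψ)
subF-id h (φ ∧' ψ) = cong₂ _∧'_ (subF-id h φ) (subF-id h ψ)
subF-id h (φ ∨' ψ) = cong₂ _∨'_ (subF-id h φ) (subF-id h ψ)
subF-id h (∀' φ)   = cong ∀' (subF-id (lift-id h) φ)
subF-id h (∃' φ)   = cong ∃' (subF-id (lift-id h) φ)

instantiate-weakened : ∀ φ → subF (lift weaken) φ [ var 0 ] ≡ φ
instantiate-weakened φ =
  trans (subF-fusion {ρ = var} (λ { zero → refl ; (suc _) → refl }) φ)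
        (subF-id (λ _ → refl) φ)

∃I-fresh : ∀ {Ax Γ φ} → Ax ∣ Γ ⊢ φ → Ax ∣ Γ ⊢ ∃' (subF (lift weaken) φ)
∃I-fresh {Ax} {Γ} {φ} d =
  ∃I (var 0) (subst (Ax ∣ Γ ⊢_) (sym (instantiate-weakened φ)) d)

∀E-fresh : ∀ {Ax Γ φ} → Ax ∣ Γ ⊢ ∀' (subF (lift weaken) φ) → Ax ∣ Γ ⊢ φ
∀E-fresh {Ax} {Γ} {φ} d = subst (Ax ∣ Γ ⊢_) (instantiate-weakened φ) (∀E d (var 0))

-- Derivability in every context; it stands in for a weakening lemma for derivations.
infix 2 _⊩_
_⊩_ : Theory → Fm → Set
Ax ⊩ φ = ∀ Γ → Ax ∣ Γ ⊢ φ

∨-comm : ∀ {Ax φ ψ} → Ax ⊩ φ ∨' ψ → Ax ⊩ ψ ∨' φ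
∨-comm d Γ = ∨E (d Γ) (∨I₂ (hyp (here refl))) (∨I₁ (hyp (here refl)))

⇒¬-swap : ∀ {Ax φ ψ} → Ax ⊩ ψ ⇒ ¬' φ → Ax ⊩ φ ⇒ ¬' ψ
⇒¬-swap d Γ = ⇒I (⇒I (⇒E (⇒E (d _) (hyp (here refl))) (hyp (there (here refl)))))

pa-lem : ∀ φ → PA-Ax ⊩ φ ∨' ¬' φ
pa-lem φ Γ = subst (PA-Ax ∣ Γ ⊢_) (subF-id (λ _ → refl) (φ ∨' ¬' φ)) (ax (lem φ) var)

pa-∃∨∀ : ∀ {φ ψ} → PA-Ax ⊩ φ ∨' ψ → PA-Ax ⊩ ∃' φ ∨' ∀' ψ
pa-∃∨∀ {φ} d Γ =
  ∨E (pa-lem (∃' φ) Γ)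
    (∨I₁ (hyp (here refl)))
    (∨I₂ (∀I (∨E (d _)
      (⊥E (⇒E (hyp (there (here refl))) (∃I-fresh (hyp (here refl)))))
      (hyp (here refl)))))

pa-∀∨∃ : ∀ {φ ψ} → PA-Ax ⊩ φ ∨' ψ → PA-Ax ⊩ ∀' φ ∨' ∃' ψ
pa-∀∨∃ d = ∨-comm (pa-∃∨∀ (∨-comm d))

∀⇒¬∃ : ∀ {Ax φ ψ} → Ax ⊩ ψ ⇒ ¬' φ → Ax ⊩ ∀' ψ ⇒ ¬' (∃' φ)
∀⇒¬∃ d Γ =
  ⇒I (⇒I (∃E (hyp (here refl))
    (⇒E (⇒E (d _) (∀E-fresh (hyp (there (there (here refl)))))) (hyp (here refl)))))

∃⇒¬∀ : ∀ {Ax φ ψ} → Ax ⊩ ψ ⇒ ¬' φ → Ax ⊩ ∃' ψ ⇒ ¬' (∀' φ)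
∃⇒¬∀ d = ⇒¬-swap (∀⇒¬∃ (⇒¬-swap d))

mutual
  dualΣ : ∀ {k φ} → Sig k φ → Fm
  dualΣ (sig0 {φ} _) = ¬' φ
  dualΣ (sigΠ p)     = dualΠ p
  dualΣ (sig∃ s)     = ∀' (dualΣ s)

  dualΠ : ∀ {k φ} → Pi k φ → Fm
  dualΠ (pi0 {φ} _) = ¬' φ
  dualΠ (piΣ s)     = dualΣ s
  dualΠ (pi∀ p)     = ∃' (dualΠ p)

mutual
  dualΣ-Pi : ∀ {k φ} (s : Sig k φ) → Pi k (dualΣ s)
  dualΣ-Pi (sig0 q) = pi0 (qf⇒ q qf⊥)
  dualΣ-Pi (sigΠ p) = piΣ (dualΠ-Sig p)
  dualΣ-Pi (sig∃ s) = pi∀ (dualΣ-Pi s)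

  dualΠ-Sig : ∀ {k φ} (p : Pi k φ) → Sig k (dualΠ p)
  dualΠ-Sig (pi0 q) = sig0 (qf⇒ q qf⊥)
  dualΠ-Sig (piΣ s) = sigΠ (dualΣ-Pi s)
  dualΠ-Sig (pi∀ p) = sig∃ (dualΠ-Sig p)

mutual
  pa-Σ∨dual : ∀ {k φ} (s : Sig k φ) → PA-Ax ⊩ φ ∨' dualΣ s
  pa-Σ∨dual (sig0 {φ} _) = pa-lem φ
  pa-Σ∨dual (sigΠ p)     = pa-Π∨dual p
  pa-Σ∨dual (sig∃ s)     = pa-∃∨∀ (pa-Σ∨dual s)

  pa-Π∨dual : ∀ {k φ} (p : Pi k φ) → PA-Ax ⊩ φ ∨' dualΠ p
  pa-Π∨dual (pi0 {φ} _) = pa-lem φ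
  pa-Π∨dual (piΣ s)     = pa-Σ∨dual s
  pa-Π∨dual (pi∀ p)     = pa-∀∨∃ (pa-Π∨dual p)

mutual
  dualΣ⇒¬ : ∀ {Ax k φ} (s : Sig k φ) → Ax ⊩ dualΣ s ⇒ ¬' φ
  dualΣ⇒¬ (sig0 _) Γ = ⇒I (hyp (here refl))
  dualΣ⇒¬ (sigΠ p)   = dualΠ⇒¬ p
  dualΣ⇒¬ (sig∃ s)   = ∀⇒¬∃ (dualΣ⇒¬ s)

  dualΠ⇒¬ : ∀ {Ax k φ} (p : Pi k φ) → Ax ⊩ dualΠ p ⇒ ¬' φ
  dualΠ⇒¬ (pi0 _) Γ = ⇒I (hyp (here refl))
  dualΠ⇒¬ (piΣ s)   = dualΣ⇒¬ s
  dualΠ⇒¬ (pi∀ p)   = ∃⇒¬∀ (dualΠ⇒¬ p)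

lemma5p5 : (k : ℕ) (T : Theory) → ContainsHA T →
    Conservative (SigOrPi k) PA-Ax T → ProvesLEM-Sig k T
lemma5p5 k T _ conservative φ s =
  ∨E (conservative _ (sigOrPi s (dualΣ-Pi s)) (pa-Σ∨dual s []))
    (∨I₁ (hyp (here refl)))
    (∨I₂ (⇒E (dualΣ⇒¬ s _) (hyp (here refl))))
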